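{- For every instance and every starvation threshold $\theta\ge0$, let $t^*\in\mathbb{N}$ be a time maximizing $u(t)$. Then there is a function $h:\{1,\dots,n\}\to[0,\infty)$ with $h(i)\le q_{t^*,\mathcal{SRPT}}(i)$ for all $i$, such that $\sum_{i=1}^n h(i)^2\le\sum_{i=1}^n q_{t_i}(i)^2$ and $\sum_{i=1}^n h(i)\ge\frac14\,u(t^*)$.
   Context: Problem: a single machine and $n$ jobs; job $J_i$ has integer release time $r_i\ge0$ and integer processing time $p_i\ge1$. Unit slots $[t]=[t,t+1)$, $t\in\mathbb{N}$. A schedule assigns each slot to at most one job, $J_i$ receiving exactly $p_i$ slots all with $t\ge r_i$. View $J_i$ as unit tasks $J_{i,1},\dots,J_{i,p_i}$ (the $k$-th slot of $J_i$ executes $J_{i,k}$; a task in slot $[t]$ completes at $t+1$); $c_i$ denotes completion time of $J_i$. $J_i$ is active at $t$ under $\mathcal{S}$ if $r_i\le t<c_i(\mathcal{S})$; $q_{t,\mathcal{S}}(i)$ is the number of its tasks not executed in slots before $t$ if active, and $0$ otherwise. SRPT: fix a schedule $\mathcal{SRPT}$ executing in each slot an active job of least remaining processing time (fixed tie-breaking); $M_{SRPT}(t)$ = tasks executed in slots $[0],\dots,[t]$ by it. Algorithm $BAL(\theta)$: $q_t(i)=q_{t,\mathcal{BAL}}(i)$, $M_{BAL}(t)$ = tasks it executes in slots $[0],\dots,[t]$, $M_{BAL}(-1)=\varnothing$. Initially all jobs are normal. At each $t$: every active, not-yet-starving job with $(t-r_i)/q_t(i)\ge\theta$ becomes starving,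 recording $t_i=t$, $\gamma_i=(t-r_i)/q_t(i)$ (it remains starving until completion). If some active job is starving, slot $[t]$ executes the starving active job with smallest $t_i$ (ties: largest $\gamma_i$, then smallest index); otherwise, if $M_{SRPT}(t)\setminus M_{BAL}(t-1)\neq\varnothing$, it executes the task in that set with the smallest completion time under $\mathcal{SRPT}$. For a job that never becomes starving, $t_i:=c_i(\mathcal{BAL})$ (so $q_{t_i}(i)=0$). The number of starving tasks at time $t$ is $u(t)=\sum_{i:\,J_i\text{ becomes starving and }t_i\le t} q_t(i)$.
   Formalization: The starvation threshold θ ranges over the nonnegative rationals, and the function h takes values in the nonnegative rationals. -}

module Defs where

open import Data.Nat as ℕ using (ℕ; zero; suc; _+_; _*_; _∸_; _≤_; _<_; _≤ᵇ_; _<ᵇ_)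
open import Data.Fin as Fin using (Fin; toℕ)
open import Data.Bool using (Bool; true; false; if_then_else_; _∧_)
open import Data.Maybe using (Maybe; just; nothing)
open import Data.Maybe.Properties using (≡-dec)
open import Data.Integer using (+_)
open import Data.Rational as ℚ using (ℚ; _/_; 0ℚ)
open import Data.Product using (Σ; Σ-syntax; _×_)
open import Data.Sum using (_⊎_)
open import Relation.Nullary using (¬_; does)
open import Relation.Binary.PropositionalEquality using (_≡_)

toℚ : ℕ → ℚ
toℚ m = + m / 1

sumℕ : ∀ {n} → (Fin n → ℕ) → ℕ
sumℕ {zero}  f = 0
sumℕ {suc n} f = f Fin.zero + sumℕ (λ i → f (Fin.suc i))

sumℚ : ∀ {n} → (Fin n → ℚ) → ℚ
sumℚ {zero}  f = 0ℚ
sumℚ {suc n} f = f Fin.zero ℚ.+ sumℚ (λ i → f (Fin.suc i))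

firstUpTo : (ℕ → Bool) → ℕ → Maybe ℕ
firstUpTo f zero = if f 0 then just 0 else nothing
firstUpTo f (suc t) with firstUpTo f t
... | just s  = just s
... | nothing = if f (suc t) then just (suc t) else nothing

-- A schedule is a function ℕ → Maybe (Fin n): slot [t] runs job i (just i) or is idle.

module _ {n : ℕ} (r p : Fin n → ℕ) where

  exec : (ℕ → Maybe (Fin n)) → Fin n → ℕ → ℕ
  exec S i zero    = 0
  exec S i (suc t) = exec S i t + (if does (≡-dec Fin._≟_ (S t) (just i)) then 1 else 0)

  -- J_i active at t under S : r_i ≤ t < c_i(S), i.e. released and not all tasks done before t
  activeB : (ℕ → Maybe (Fin n)) → ℕ → Fin n → Bool
  activeB S t i = (r i ≤ᵇ t) ∧ (exec S i t <ᵇ p i)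

  Active : (ℕ → Maybe (Fin n)) → ℕ → Fin n → Set
  Active S t i = activeB S t i ≡ true

  q : (ℕ → Maybe (Fin n)) → ℕ → Fin n → ℕ
  q S t i = if activeB S t i then p i ∸ exec S i t else 0

  IsSRPT : (ℕ → Maybe (Fin n)) → Set
  IsSRPT S = ∀ t →
      (Σ[ i ∈ Fin n ] (S t ≡ just i × Active S t i × (∀ j → Active S t j → q S t i ≤ q S t j)))
    ⊎ (S t ≡ nothing × (∀ j → ¬ Active S t j))

  -- completion time c of the k-th task J_{i,k} under S (it runs in slot [s], c = s+1)
  TaskCompl : (ℕ → Maybe (Fin n)) → Fin n → ℕ → ℕ → Set
  TaskCompl S i k c = Σ[ s ∈ ℕ ] (S s ≡ just i × suc (exec S i s) ≡ k × c ≡ suc s)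

  IsCompl : (ℕ → Maybe (Fin n)) → Fin n → ℕ → Set
  IsCompl S i c = exec S i c ≡ p i × (∀ c′ → c′ < c → exec S i c′ < p i)

  module _ (θ : ℚ) (σ : ℕ → Maybe (Fin n)) (β : ℕ → Maybe (Fin n)) where

    -- starving condition at t under BAL: active and (t - r_i)/q_t(i) ≥ θ
    -- (written as θ · q_t(i) ≤ t - r_i, q_t(i) > 0 when active)
    starveCond : Fin n → ℕ → Bool
    starveCond i t = activeB β t i ∧ (θ ℚ.* toℚ (q β t i) ℚ.≤ᵇ toℚ (t ∸ r i))

    starvedBy : Fin n → ℕ → Maybe ℕ
    starvedBy i t = firstUpTo (starveCond i) t

    StarvAct : ℕ → Fin n → ℕ → Set
    StarvAct t i s = starvedBy i t ≡ just s × Active β t i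

    -- priority among starving jobs: smaller t_i, then larger γ_i, then smaller index;
    -- γ_i = (t_i - r_i)/q_{t_i}(i), compared by cross-multiplication
    Pref : Fin n → ℕ → Fin n → ℕ → Set
    Pref i si j sj =
        si < sj
      ⊎ (si ≡ sj × (sj ∸ r j) * q β si i < (si ∸ r i) * q β sj j)
      ⊎ (si ≡ sj × (sj ∸ r j) * q β si i ≡ (si ∸ r i) * q β sj j × toℕ i ≤ toℕ j)

    -- task J_{i,k} lies in M_SRPT(t) \ M_BAL(t-1)
    InDiff : ℕ → Fin n → ℕ → Set
    InDiff t i k = 1 ≤ k × k ≤ exec σ i (suc t) × exec β i t < k

    IsBAL : Set
    IsBAL = ∀ t →
        (Σ[ i ∈ Fin n ] Σ[ si ∈ ℕ ] (StarvAct t i si × β t ≡ just i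
            × (∀ j sj → StarvAct t j sj → Pref i si j sj)))
      ⊎ ((∀ j sj → ¬ StarvAct t j sj)
          × Σ[ i ∈ Fin n ] Σ[ k ∈ ℕ ] (InDiff t i k × β t ≡ just i
            × (∀ j l → InDiff t j l → ∀ c c′ → TaskCompl σ i k c → TaskCompl σ j l c′ → c ≤ c′)))
      ⊎ ((∀ j sj → ¬ StarvAct t j sj) × (∀ j l → ¬ InDiff t j l) × β t ≡ nothing)

    IsTi : Fin n → ℕ → Set
    IsTi i τ = starvedBy i τ ≡ just τ ⊎ ((∀ s → starveCond i s ≡ false) × IsCompl β i τ)

    -- u(t): number of starving tasks at t
    u : ℕ → ℕ
    u t = sumℕ (λ i → f (starvedBy i t) i)
      where
      f : Maybe ℕ → Fin n → ℕ
      f (just _) i = q β t i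
      f nothing  i = 0

{-# OPTIONS --safe #-}
-- Take h(i) = min(q_{t*,SRPT}(i), q_{t_i}(i)), so only u(t*) ≤ ∑ h needs proof; it holds at
-- every time t. Before J_j starves, BAL executes only tasks of J_j that SRPT has executed, so
-- up to t_j BAL is behind SRPT on J_j. Hence for J_j starving by t,
-- q_t(j) + (BAL's work on J_j by t) ≤ p_j ≤ h(j) + (SRPT's work on J_j by t), and for a normal
-- J_j BAL's work is at most SRPT's. Summing over j, and using that BAL idles only when it has
-- caught up with SRPT (so its total work is at least SRPT's), gives u(t) ≤ ∑ h.
module Submission where

open import Defs
open import Data.Bool using (true; false; if_then_else_; T)
open import Data.Bool.Properties using (T-≡; T-∧)
open import Data.Fin as Fin using (Fin)
open import Data.Integer as ℤ using (+_)
import Data.Integer.Properties as ℤ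
open import Data.Maybe using (Maybe; just; nothing)
open import Data.Maybe.Properties using (≡-dec; just-injective)
open import Data.Nat using (ℕ; zero; suc; _+_; _*_; _≤_; _<_; _⊓_; z≤n; s≤s)
open import Data.Nat.Coprimality using (1-coprimeTo) renaming (sym to coprime-sym)
open import Data.Nat.Properties
open import Algebra.Properties.CommutativeSemigroup +-commutativeSemigroup using (interchange)
open import Data.Product using (Σ; Σ-syntax; _×_; _,_; proj₁; proj₂)
open import Data.Rational as ℚ using (ℚ; 0ℚ; _/_)
import Data.Rational.Properties as ℚ
import Data.Rational.Unnormalised as ℚᵘ
import Data.Rational.Unnormalised.Properties as ℚᵘ
open import Data.Sum using (_⊎_; inj₁; inj₂)
open import Function using (Equivalence; case_of_)
open import Relation.Binary.PropositionalEquality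
open import Relation.Nullary using (does; yes; no)

sumℕ-+ : ∀ {n} (f g : Fin n → ℕ) → sumℕ (λ i → f i + g i) ≡ sumℕ f + sumℕ g
sumℕ-+ {zero}  f g = refl
sumℕ-+ {suc n} f g = begin
  f Fin.zero + g Fin.zero + sumℕ (λ i → f (Fin.suc i) + g (Fin.suc i))
    ≡⟨ cong (λ s → f Fin.zero + g Fin.zero + s)
            (sumℕ-+ (λ i → f (Fin.suc i)) (λ i → g (Fin.suc i))) ⟩
  f Fin.zero + g Fin.zero + (sumℕ (λ i → f (Fin.suc i)) + sumℕ (λ i → g (Fin.suc i)))
    ≡⟨ interchange (f Fin.zero) (g Fin.zero) _ _ ⟩
  sumℕ f + sumℕ g ∎
  where open ≡-Reasoning

sumℕ-mono : ∀ {n} {f g : Fin n → ℕ} → (∀ i → f i ≤ g i) → sumℕ f ≤ sumℕ g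
sumℕ-mono {zero}  f≤g = z≤n
sumℕ-mono {suc n} f≤g = +-mono-≤ (f≤g Fin.zero) (sumℕ-mono (λ i → f≤g (Fin.suc i)))

sumℕ-zero : ∀ n → sumℕ {n} (λ _ → 0) ≡ 0
sumℕ-zero zero    = refl
sumℕ-zero (suc n) = sumℕ-zero n

sumℕ-mono-cancel : ∀ {n} {f f′ g g′ : Fin n → ℕ} →
  (∀ i → f i + g i ≤ f′ i + g′ i) → sumℕ g′ ≤ sumℕ g → sumℕ f ≤ sumℕ f′
sumℕ-mono-cancel {f = f} {f′} {g} {g′} pointwise g′≤g =
  +-cancelʳ-≤ (sumℕ g) (sumℕ f) (sumℕ f′) (begin
  sumℕ f + sumℕ g             ≡⟨ sumℕ-+ f g ⟨
  sumℕ (λ i → f i + g i)      ≤⟨ sumℕ-mono pointwise ⟩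
  sumℕ (λ i → f′ i + g′ i)    ≡⟨ sumℕ-+ f′ g′ ⟩
  sumℕ f′ + sumℕ g′           ≤⟨ +-monoʳ-≤ (sumℕ f′) g′≤g ⟩
  sumℕ f′ + sumℕ g            ∎)
  where open ≤-Reasoning

sumℚ-cong : ∀ {n} {f g : Fin n → ℚ} → (∀ i → f i ≡ g i) → sumℚ f ≡ sumℚ g
sumℚ-cong {zero}  f≡g = refl
sumℚ-cong {suc n} f≡g = cong₂ ℚ._+_ (f≡g Fin.zero) (sumℚ-cong (λ i → f≡g (Fin.suc i)))

toℚᵘ-toℚ : ∀ m → ℚ.toℚᵘ (toℚ m) ≡ ℚᵘ.mkℚᵘ (+ m) 0
toℚᵘ-toℚ m = cong ℚ.toℚᵘ (ℚ.normalize-coprime (coprime-sym (1-coprimeTo m)))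

toℚ-≡ : ∀ {m x} → ℚᵘ.mkℚᵘ (+ m) 0 ℚᵘ.≃ ℚ.toℚᵘ x → toℚ m ≡ x
toℚ-≡ {m} eq = ℚ.toℚᵘ-injective (ℚᵘ.≃-trans (ℚᵘ.≃-reflexive (toℚᵘ-toℚ m)) eq)

toℚ-+ : ∀ a b → toℚ (a + b) ≡ toℚ a ℚ.+ toℚ b
toℚ-+ a b = toℚ-≡ (begin
  ℚᵘ.mkℚᵘ (+ (a + b)) 0                          ≈⟨ ℚᵘ.*≡* numerators ⟩
  ℚᵘ.mkℚᵘ (+ a) 0 ℚᵘ.+ ℚᵘ.mkℚᵘ (+ b) 0           ≡⟨ cong₂ ℚᵘ._+_ (toℚᵘ-toℚ a) (toℚᵘ-toℚ b) ⟨
  ℚ.toℚᵘ (toℚ a) ℚᵘ.+ ℚ.toℚᵘ (toℚ b)             ≈⟨ ℚ.toℚᵘ-homo-+ (toℚ a) (toℚ b) ⟨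
  ℚ.toℚᵘ (toℚ a ℚ.+ toℚ b)                       ∎)
  where
  open ℚᵘ.≃-Reasoning
  numerators : + (a + b) ℤ.* + 1 ≡ (+ a ℤ.* + 1 ℤ.+ + b ℤ.* + 1) ℤ.* + 1
  numerators rewrite ℤ.*-identityʳ (+ (a + b)) | ℤ.*-identityʳ (+ a) | ℤ.*-identityʳ (+ b)
                   | ℤ.*-identityʳ (+ a ℤ.+ + b) = ℤ.pos-+ a b

toℚ-* : ∀ a b → toℚ (a * b) ≡ toℚ a ℚ.* toℚ b
toℚ-* a b = toℚ-≡ (begin
  ℚᵘ.mkℚᵘ (+ (a * b)) 0                          ≈⟨ ℚᵘ.*≡* numerators ⟩
  ℚᵘ.mkℚᵘ (+ a) 0 ℚᵘ.* ℚᵘ.mkℚᵘ (+ b) 0           ≡⟨ cong₂ ℚᵘ._*_ (toℚᵘ-toℚ a) (toℚᵘ-toℚ b) ⟨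
  ℚ.toℚᵘ (toℚ a) ℚᵘ.* ℚ.toℚᵘ (toℚ b)             ≈⟨ ℚ.toℚᵘ-homo-* (toℚ a) (toℚ b) ⟨
  ℚ.toℚᵘ (toℚ a ℚ.* toℚ b)                       ∎)
  where
  open ℚᵘ.≃-Reasoning
  numerators : + (a * b) ℤ.* + 1 ≡ (+ a ℤ.* + b) ℤ.* + 1
  numerators rewrite ℤ.*-identityʳ (+ (a * b)) | ℤ.*-identityʳ (+ a ℤ.* + b) = ℤ.pos-* a b

toℚ-mono : ∀ {a b} → a ≤ b → toℚ a ℚ.≤ toℚ b
toℚ-mono {a} {b} a≤b = ℚ.toℚᵘ-cancel-≤
  (subst₂ ℚᵘ._≤_ (sym (toℚᵘ-toℚ a)) (sym (toℚᵘ-toℚ b))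
    (ℚᵘ.*≤* (ℤ.*-monoʳ-≤-nonNeg (+ 1) (ℤ.+≤+ a≤b))))

toℚ-nonNeg : ∀ m → 0ℚ ℚ.≤ toℚ m
toℚ-nonNeg m = toℚ-mono {0} {m} z≤n

sumℚ-toℚ : ∀ {n} (f : Fin n → ℕ) → sumℚ (λ i → toℚ (f i)) ≡ toℚ (sumℕ f)
sumℚ-toℚ {zero}  f = refl
sumℚ-toℚ {suc n} f = begin
  toℚ (f Fin.zero) ℚ.+ sumℚ (λ i → toℚ (f (Fin.suc i)))
    ≡⟨ cong (toℚ (f Fin.zero) ℚ.+_) (sumℚ-toℚ (λ i → f (Fin.suc i))) ⟩
  toℚ (f Fin.zero) ℚ.+ toℚ (sumℕ (λ i → f (Fin.suc i)))
    ≡⟨ toℚ-+ (f Fin.zero) _ ⟨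
  toℚ (sumℕ f) ∎
  where open ≡-Reasoning

sumℚ-squares-≤ : ∀ {n} {f g : Fin n → ℕ} → (∀ i → f i ≤ g i) →
  sumℚ (λ i → toℚ (f i) ℚ.* toℚ (f i)) ℚ.≤ toℚ (sumℕ (λ i → g i * g i))
sumℚ-squares-≤ {f = f} {g} f≤g = begin
  sumℚ (λ i → toℚ (f i) ℚ.* toℚ (f i))  ≡⟨ sumℚ-cong (λ i → toℚ-* (f i) (f i)) ⟨
  sumℚ (λ i → toℚ (f i * f i))          ≡⟨ sumℚ-toℚ (λ i → f i * f i) ⟩
  toℚ (sumℕ (λ i → f i * f i))          ≤⟨ toℚ-mono (sumℕ-mono λ i → *-mono-≤ (f≤g i) (f≤g i)) ⟩
  toℚ (sumℕ (λ i → g i * g i))          ∎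
  where open ℚ.≤-Reasoning

≤1⇒*-toℚ-≤ : ∀ {x m n} → x ℚ.≤ ℚ.1ℚ → m ≤ n → x ℚ.* toℚ m ℚ.≤ toℚ n
≤1⇒*-toℚ-≤ {x} {m} {n} x≤1 m≤n = begin
  x ℚ.* toℚ m     ≤⟨ ℚ.*-monoʳ-≤-nonNeg (toℚ m) {{ℚ.nonNegative (toℚ-nonNeg m)}} x≤1 ⟩
  ℚ.1ℚ ℚ.* toℚ m  ≡⟨ ℚ.*-identityˡ (toℚ m) ⟩
  toℚ m           ≤⟨ toℚ-mono m≤n ⟩
  toℚ n           ∎
  where open ℚ.≤-Reasoning

firstUpTo-just : ∀ f t {s} → firstUpTo f t ≡ just s →
  f s ≡ true × s ≤ t × (∀ x → x < s → f x ≡ false)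
firstUpTo-nothing : ∀ f t → firstUpTo f t ≡ nothing → ∀ x → x ≤ t → f x ≡ false

firstUpTo-just f zero eq with f 0 in f0
firstUpTo-just f zero refl | true  = f0 , z≤n , λ _ ()
firstUpTo-just f zero ()   | false
firstUpTo-just f (suc t) eq with firstUpTo f t in earlier
firstUpTo-just f (suc t) refl | just s =
  let fs , s≤t , before = firstUpTo-just f t earlier in fs , m≤n⇒m≤1+n s≤t , before
firstUpTo-just f (suc t) eq | nothing with f (suc t) in ft
firstUpTo-just f (suc t) refl | nothing | true =
  ft , ≤-refl , λ x x<1+t → firstUpTo-nothing f t earlier x (≤-pred x<1+t)
firstUpTo-just f (suc t) () | nothing | false

firstUpTo-nothing f zero eq zero z≤n with f 0 in f0
firstUpTo-nothing f zero () zero z≤n | true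
firstUpTo-nothing f zero eq zero z≤n | false = refl
firstUpTo-nothing f (suc t) eq x x≤1+t with firstUpTo f t in earlier
firstUpTo-nothing f (suc t) () x x≤1+t | just _
firstUpTo-nothing f (suc t) eq x x≤1+t | nothing with f (suc t) in ft
firstUpTo-nothing f (suc t) () x x≤1+t | nothing | true
firstUpTo-nothing f (suc t) eq x x≤1+t | nothing | false with m≤n⇒m<n∨m≡n x≤1+t
... | inj₁ x<1+t = firstUpTo-nothing f t earlier x (≤-pred x<1+t)
... | inj₂ refl  = ft

occupied : ∀ {A : Set} → Maybe A → ℕ
occupied (just _) = 1
occupied nothing  = 0

occupied≤1 : ∀ {A : Set} (x : Maybe A) → occupied x ≤ 1
occupied≤1 (just _) = ≤-refl
occupied≤1 nothing  = z≤n

-- The increment in the definition of exec, so that exec S i (suc t) ≡ exec S i t + ran (S t) i by refl.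
ran : ∀ {n} → Maybe (Fin n) → Fin n → ℕ
ran x i = if does (≡-dec Fin._≟_ x (just i)) then 1 else 0

sumℕ-ran : ∀ {n} (x : Maybe (Fin n)) → sumℕ (ran x) ≡ occupied x
sumℕ-ran {n}     nothing            = sumℕ-zero n
sumℕ-ran {suc n} (just Fin.zero)    = cong suc (sumℕ-zero n)
sumℕ-ran {suc n} (just (Fin.suc i)) = sumℕ-ran (just i)

-- The summand of u t is local to its definition; unifying u t with sumℕ f recovers it.
summand : ∀ {n m} {f : Fin n → ℕ} → m ≡ sumℕ f → Fin n → ℕ
summand {f = f} _ = f

module Schedule {n : ℕ} (r p : Fin n → ℕ) where

  exec-suc : ∀ S j t →
      (S t ≡ just j × exec r p S j (suc t) ≡ suc (exec r p S j t))
    ⊎ exec r p S j (suc t) ≡ exec r p S j t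
  exec-suc S j t with ≡-dec Fin._≟_ (S t) (just j)
  ... | yes St = inj₁ (St , +-comm _ 1)
  ... | no  _  = inj₂ (+-identityʳ _)

  exec-mono : ∀ S j {s t} → s ≤ t → exec r p S j s ≤ exec r p S j t
  exec-mono S j {t = zero}  z≤n = ≤-refl
  exec-mono S j {t = suc t} s≤1+t with m≤n⇒m<n∨m≡n s≤1+t
  ... | inj₁ s<1+t = ≤-trans (exec-mono S j (≤-pred s<1+t)) (m≤m+n _ _)
  ... | inj₂ refl  = ≤-refl

  work : (ℕ → Maybe (Fin n)) → ℕ → ℕ
  work S t = sumℕ (λ j → exec r p S j t)

  work-suc : ∀ S t → work S (suc t) ≡ work S t + occupied (S t)
  work-suc S t = trans (sumℕ-+ (λ j → exec r p S j t) (ran (S t)))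
                       (cong (λ w → work S t + w) (sumℕ-ran (S t)))

  Active⇒released×unfinished : ∀ {S t i} → Active r p S t i → r i ≤ t × exec r p S i t < p i
  Active⇒released×unfinished act
    with released , unfinished ← Equivalence.to T-∧ (Equivalence.from T-≡ act) =
    ≤ᵇ⇒≤ _ _ released , <ᵇ⇒< _ _ unfinished

  q+exec≤p : ∀ S t i → exec r p S i t ≤ p i → q r p S t i + exec r p S i t ≤ p i
  q+exec≤p S t i e≤p with activeB r p S t i
  ... | true  = ≤-reflexive (m∸n+n≡m e≤p)
  ... | false = e≤p

  p≤q+exec : ∀ S t i → r i ≤ t → p i ≤ q r p S t i + exec r p S i t
  p≤q+exec S t i r≤t with activeB r p S t i in act
  ... | true  = subst (p i ≤_) (+-comm (exec r p S i t) _) (m≤n+m∸n (p i) (exec r p S i t))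
  ... | false = ≮⇒≥ λ e<p → subst T act (Equivalence.from T-∧ (≤⇒≤ᵇ r≤t , <⇒<ᵇ e<p))

  RunsUnfinished : (ℕ → Maybe (Fin n)) → Set
  RunsUnfinished S = ∀ {t j} → S t ≡ just j → exec r p S j t < p j

  RunsUnfinished⇒exec≤p : ∀ {S} → RunsUnfinished S → ∀ j t → exec r p S j t ≤ p j
  RunsUnfinished⇒exec≤p         runs j zero    = z≤n
  RunsUnfinished⇒exec≤p {S = S} runs j (suc t) with exec-suc S j t
  ... | inj₁ (St , grows) = subst (_≤ p j) (sym grows) (runs St)
  ... | inj₂ stays        = subst (_≤ p j) (sym stays) (RunsUnfinished⇒exec≤p runs j t)

  srpt-runsUnfinished : ∀ {σ} → IsSRPT r p σ → RunsUnfinished σ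
  srpt-runsUnfinished srpt {t} σt with srpt t
  ... | inj₁ (_ , σt′ , act , _) with refl ← just-injective (trans (sym σt′) σt) =
    proj₂ (Active⇒released×unfinished act)
  ... | inj₂ (σt′ , _) with () ← trans (sym σt′) σt

  -- Case splits below use case rather than with: with-abstraction over hypotheses mentioning
  -- starveCond normalises its rational arithmetic and is prohibitively slow.
  module BAL (θ : ℚ) (σ β : ℕ → Maybe (Fin n)) where

    NormalBefore : Fin n → ℕ → Set
    NormalBefore j s = ∀ x → x < s → starveCond r p θ σ β j x ≡ false

    starveCond⇒Active : ∀ {j t} → starveCond r p θ σ β j t ≡ true → Active r p β t j
    starveCond⇒Active sc = Equivalence.to T-≡ (proj₁ (Equivalence.to T-∧ (Equivalence.from T-≡ sc)))

    Runnable : ℕ → Fin n → Set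
    Runnable t j =
        ((Σ[ s ∈ ℕ ] starvedBy r p θ σ β j t ≡ just s) × Active r p β t j)
      ⊎ exec r p β j t < exec r p σ j (suc t)

    bal-slot : IsBAL r p θ σ β → ∀ {t j} → β t ≡ just j → Runnable t j
    bal-slot bal {t} {j} βt = case bal t of λ where
      (inj₁ (_ , s , (starved , act) , βt′ , _)) →
        subst (Runnable t) (same βt′) (inj₁ ((s , starved) , act))
      (inj₂ (inj₁ (_ , _ , _ , (_ , k≤σ , β<k) , βt′ , _))) →
        subst (Runnable t) (same βt′) (inj₂ (<-≤-trans β<k k≤σ))
      (inj₂ (inj₂ (_ , _ , βt′))) → case trans (sym βt′) βt of λ ()
     where
      same : ∀ {i} → β t ≡ just i → i ≡ j
      same βt′ = just-injective (trans (sym βt′) βt)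

    bal-idle : IsBAL r p θ σ β → ∀ {t} → β t ≡ nothing →
      ∀ j → exec r p σ j (suc t) ≤ exec r p β j t
    bal-idle bal {t} βt j = case bal t of λ where
      (inj₁ (_ , _ , _ , βt′ , _))            → case trans (sym βt) βt′ of λ ()
      (inj₂ (inj₁ (_ , _ , _ , _ , βt′ , _))) → case trans (sym βt) βt′ of λ ()
      (inj₂ (inj₂ (_ , nothingPending , _)))  →
        ≮⇒≥ λ β<σ → nothingPending j _ (≤-trans (s≤s z≤n) β<σ , ≤-refl , β<σ)

    bal-runsUnfinished : IsSRPT r p σ → IsBAL r p θ σ β → RunsUnfinished β
    bal-runsUnfinished srpt bal {t} {j} βt = case bal-slot bal βt of λ where
      (inj₁ (_ , act)) → proj₂ (Active⇒released×unfinished act)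
      (inj₂ behind)    →
        <-≤-trans behind (RunsUnfinished⇒exec≤p (srpt-runsUnfinished srpt) j (suc t))

    normal⇒bal-exec≤srpt : IsBAL r p θ σ β → ∀ {j s} → NormalBefore j s →
      exec r p β j s ≤ exec r p σ j s
    normal⇒bal-exec≤srpt bal {s = zero}      _      = z≤n
    normal⇒bal-exec≤srpt bal {j} {s = suc s} normal = case exec-suc β j s of λ where
      (inj₂ stays) → subst (_≤ exec r p σ j (suc s)) (sym stays)
        (≤-trans (normal⇒bal-exec≤srpt bal λ x x<s → normal x (m<n⇒m<1+n x<s)) (m≤m+n _ _))
      (inj₁ (βs , grows)) → case bal-slot bal βs of λ where
        (inj₂ behind)              → subst (_≤ exec r p σ j (suc s)) (sym grows) behind
        (inj₁ ((x , starved) , _)) →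
          let starving , x≤s , _ = firstUpTo-just _ s starved
          in case trans (sym starving) (normal x (s≤s x≤s)) of λ ()

    srpt-work≤bal-work : IsBAL r p θ σ β → ∀ t → work σ t ≤ work β t
    srpt-work≤bal-work bal zero    = ≤-refl
    srpt-work≤bal-work bal (suc t) = begin
      work σ (suc t)              ≤⟨ bound (β t) refl ⟩
      work β t + occupied (β t)   ≡⟨ work-suc β t ⟨
      work β (suc t)              ∎
      where
      open ≤-Reasoning
      bound : ∀ x → β t ≡ x → work σ (suc t) ≤ work β t + occupied x
      bound (just _) _  = begin
        work σ (suc t)              ≡⟨ work-suc σ t ⟩
        work σ t + occupied (σ t)   ≤⟨ +-mono-≤ (srpt-work≤bal-work bal t) (occupied≤1 (σ t)) ⟩
        work β t + 1                ∎
      bound nothing βt = begin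
        work σ (suc t)              ≤⟨ sumℕ-mono (bal-idle bal βt) ⟩
        work β t                    ≡⟨ +-identityʳ _ ⟨
        work β t + 0                ∎

    IsTi-starved : ∀ {j τ T s} → IsTi r p θ σ β j τ → starvedBy r p θ σ β j T ≡ just s →
      τ ≤ T × Active r p β τ j × NormalBefore j τ
    IsTi-starved {τ = τ} {T} (inj₁ startsAtτ) starvedByT =
      let starvingAtS , s≤T , _      = firstUpTo-just _ T starvedByT
          starvingAtτ , _   , normal = firstUpTo-just _ τ startsAtτ
      in ≤-trans (≮⇒≥ λ s<τ → case trans (sym starvingAtS) (normal _ s<τ) of λ ()) s≤T
       , starveCond⇒Active starvingAtτ
       , normal
    IsTi-starved {T = T} (inj₂ (neverStarving , _)) starvedByT =
      case trans (sym (neverStarving _)) (proj₁ (firstUpTo-just _ T starvedByT)) of λ ()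

    starvingTasks : ℕ → Fin n → ℕ
    starvingTasks t = summand {m = u r p θ σ β t} refl

    starvingTasks-starved : ∀ {t j s} → starvedBy r p θ σ β j t ≡ just s →
      starvingTasks t j ≡ q r p β t j
    starvingTasks-starved starved rewrite starved = refl

    starvingTasks-normal : ∀ {t j} → starvedBy r p θ σ β j t ≡ nothing → starvingTasks t j ≡ 0
    starvingTasks-normal notStarved rewrite notStarved = refl

    starving-job-bound : IsSRPT r p σ → IsBAL r p θ σ β → ∀ {j τ T s} →
      IsTi r p θ σ β j τ → starvedBy r p θ σ β j T ≡ just s →
      q r p β T j + exec r p β j T ≤ q r p σ T j ⊓ q r p β τ j + exec r p σ j T
    starving-job-bound srpt bal {j} {τ} {T} ti starved = begin
      q r p β T j + exec r p β j T
        ≤⟨ q+exec≤p β T j (RunsUnfinished⇒exec≤p (bal-runsUnfinished srpt bal) j T) ⟩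
      p j
        ≤⟨ ⊓-glb (p≤q+exec σ T j (≤-trans released τ≤T)) p≤qτ+exec ⟩
      (q r p σ T j + exec r p σ j T) ⊓ (q r p β τ j + exec r p σ j T)
        ≡⟨ +-distribʳ-⊓ (exec r p σ j T) _ _ ⟨
      q r p σ T j ⊓ q r p β τ j + exec r p σ j T ∎
      where
      open ≤-Reasoning
      facts : τ ≤ T × Active r p β τ j × NormalBefore j τ
      facts = IsTi-starved ti starved
      τ≤T : τ ≤ T
      τ≤T = proj₁ facts
      released : r j ≤ τ
      released = proj₁ (Active⇒released×unfinished (proj₁ (proj₂ facts)))
      p≤qτ+exec : p j ≤ q r p β τ j + exec r p σ j T
      p≤qτ+exec = ≤-trans (p≤q+exec β τ j released)
        (+-monoʳ-≤ _ (≤-trans (normal⇒bal-exec≤srpt bal (proj₂ (proj₂ facts)))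
                              (exec-mono σ j τ≤T)))

    normal-job-bound : IsBAL r p θ σ β → ∀ {j T} → starvedBy r p θ σ β j T ≡ nothing →
      exec r p β j T ≤ exec r p σ j T
    normal-job-bound bal {T = T} notStarved =
      normal⇒bal-exec≤srpt bal λ x x<T → firstUpTo-nothing _ T notStarved x (<⇒≤ x<T)

    u≤sum-min : IsSRPT r p σ → IsBAL r p θ σ β →
      (ts : Fin n → ℕ) → (∀ i → IsTi r p θ σ β i (ts i)) →
      ∀ T → u r p θ σ β T ≤ sumℕ (λ j → q r p σ T j ⊓ q r p β (ts j) j)
    u≤sum-min srpt bal ts ti T =
      sumℕ-mono-cancel (λ j → pointwise j (starvedBy r p θ σ β j T) refl) (srpt-work≤bal-work bal T)
      where
      pointwise : ∀ j x → starvedBy r p θ σ β j T ≡ x →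
        starvingTasks T j + exec r p β j T ≤ q r p σ T j ⊓ q r p β (ts j) j + exec r p σ j T
      pointwise j (just s) starved =
        subst (λ v → v + exec r p β j T ≤ _) (sym (starvingTasks-starved {T} {j} starved))
          (starving-job-bound srpt bal (ti j) starved)
      pointwise j nothing notStarved =
        subst (λ v → v + exec r p β j T ≤ _) (sym (starvingTasks-normal {T} {j} notStarved))
          (≤-trans (normal-job-bound bal {j} {T} notStarved) (m≤n+m _ _))

lemma6p5 : (n : ℕ) (r p : Fin n → ℕ) → (∀ i → 1 ≤ p i)
    → (θ : ℚ) → 0ℚ ℚ.≤ θ
    → (σ : ℕ → Maybe (Fin n)) → IsSRPT r p σ
    → (β : ℕ → Maybe (Fin n)) → IsBAL r p θ σ β
    → (ts : Fin n → ℕ) → (∀ i → IsTi r p θ σ β i (ts i))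
    → (tstar : ℕ) → (∀ t → u r p θ σ β t ≤ u r p θ σ β tstar)
    → Σ[ h ∈ (Fin n → ℚ) ]
        ((∀ i → (0ℚ ℚ.≤ h i) × (h i ℚ.≤ toℚ (q r p σ tstar i)))
        × (sumℚ (λ i → h i ℚ.* h i) ℚ.≤ toℚ (sumℕ (λ i → q r p β (ts i) i * q r p β (ts i) i)))
        × ((+ 1 / 4) ℚ.* toℚ (u r p θ σ β tstar) ℚ.≤ sumℚ h))
lemma6p5 n r p _ θ _ σ srpt β bal ts ti tstar _ =
    h
  , (λ i → toℚ-nonNeg (M i) , toℚ-mono {M i} (m⊓n≤m _ _))
  , sumℚ-squares-≤ (λ i → m⊓n≤n (q r p σ tstar i) _)
  , subst (_ ℚ.≤_) (sym (sumℚ-toℚ M))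
      (≤1⇒*-toℚ-≤ {+ 1 / 4} (ℚ.≤ᵇ⇒≤ _) (u≤sum-min srpt bal ts ti tstar))
  where
  open Schedule.BAL r p θ σ β
  M : Fin n → ℕ
  M i = q r p σ tstar i ⊓ q r p β (ts i) i
  h : Fin n → ℚ
  h i = toℚ (M i)
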